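{- Let $G$ be a bridgeless cubic graph, and assume that $G$ admits a nowhere-zero $\mathbb{Z}_2^3$-flow $f$ such that there is a nonzero $\gamma\in \mathbb{Z}_2^3$ with $f^{ -1}(\gamma)=\emptyset$. Then $G$ is $3$-edge-colorable.
   Context: Graphs are finite, undirected, without loops, possibly with parallel edges. $\mathbb{Z}_2^3$ is the elementary abelian group of order $8$. A nowhere-zero $\mathbb{Z}_2^3$-flow on $G$ is a map $f:E(G)\to\mathbb{Z}_2^3\setminus\{0\}$ such that, for some orientation of $G$, at every vertex the sum of the values on outgoing edges equals the sum of values on incoming edges (equivalently, since every element has order 2, the values on the edges incident with each vertex sum to $0$). -}

module Defs where

open import Data.Nat using (ℕ)
open import Data.Fin using (Fin; _≟_)
open import Data.Bool using (Bool; true; false; _xor_)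
open import Data.Product using (_×_; _,_; Σ; ∃; ∃-syntax)
open import Data.Sum using (_⊎_; inj₁; inj₂)
open import Data.List using (List; length; filter; map; foldr)
open import Data.List.Base using () renaming (allFin to allFinL)
open import Relation.Binary.PropositionalEquality using (_≡_; _≢_)
open import Relation.Nullary using (Dec; yes; no; ¬_)
open import Relation.Nullary.Decidable using (_⊎-dec_)

-- A finite multigraph without loops: vertices Fin n, edges Fin m,
-- each edge e has two distinct endpoints src e and tgt e
-- (parallel edges allowed).
record Graph : Set where
  field
    n      : ℕ
    m      : ℕ
    src    : Fin m → Fin n
    tgt    : Fin m → Fin n
    noLoop : ∀ e → src e ≢ tgt e

open Graph public

Incident : (G : Graph) → Fin (n G) → Fin (m G) → Set
Incident G v e = (src G e ≡ v) ⊎ (tgt G e ≡ v)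

incident? : (G : Graph) (v : Fin (n G)) (e : Fin (m G)) → Dec (Incident G v e)
incident? G v e = (src G e ≟ v) ⊎-dec (tgt G e ≟ v)

incEdges : (G : Graph) → Fin (n G) → List (Fin (m G))
incEdges G v = filter (incident? G v) (allFinL (m G))

degree : (G : Graph) → Fin (n G) → ℕ
degree G v = length (incEdges G v)

Cubic : Graph → Set
Cubic G = ∀ v → degree G v ≡ 3

data ReachWithout (G : Graph) (e : Fin (m G)) : Fin (n G) → Fin (n G) → Set where
  here : ∀ {u} → ReachWithout G e u u
  fwd  : ∀ {u} (d : Fin (m G)) → d ≢ e →
         ReachWithout G e u (src G d) → ReachWithout G e u (tgt G d)
  bwd  : ∀ {u} (d : Fin (m G)) → d ≢ e →
         ReachWithout G e u (tgt G d) → ReachWithout G e u (src G d)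

IsBridge : (G : Graph) → Fin (m G) → Set
IsBridge G e = ¬ ReachWithout G e (src G e) (tgt G e)

Bridgeless : Graph → Set
Bridgeless G = ∀ e → ¬ IsBridge G e

Z2³ : Set
Z2³ = Bool × Bool × Bool

𝟘 : Z2³
𝟘 = false , false , false

_⊕_ : Z2³ → Z2³ → Z2³
(a , b , c) ⊕ (a' , b' , c') = (a xor a') , (b xor b') , (c xor c')

IsNZFlow : (G : Graph) → (Fin (m G) → Z2³) → Set
IsNZFlow G f =
  (∀ e → f e ≢ 𝟘) ×
  (∀ v → foldr _⊕_ 𝟘 (map f (incEdges G v)) ≡ 𝟘)

ThreeEdgeColourable : Graph → Set
ThreeEdgeColourable G =
  Σ (Fin (m G) → Fin 3) λ c → (∀ (d e : Fin (m G)) → d ≢ e →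
          (∃[ v ] (Incident G v d × Incident G v e)) →
          c d ≢ c e)

-- The flow values avoid the subgroup ⟨γ⟩ = {𝟘, γ}, so they map to nonzero
-- elements of the quotient Z₂³/⟨γ⟩ ≅ Z₂², which has exactly three of them: these
-- are the colours. At a vertex of degree 3 the values sum to 𝟘, so any two of
-- them sum to the third, which lies outside ⟨γ⟩; hence they lie in different
-- cosets and get different colours.
module Submission where

open import Defs
open import Data.Bool using (Bool; true; false; _∧_; _xor_)
open import Data.Bool.Properties using (xor-comm; xor-assoc; xor-same; xor-identityʳ)
  renaming (_≟_ to _≟ᴮ_)
open import Data.Fin using (Fin; zero; suc)
open import Data.Fin.Properties using () renaming (_≟_ to _≟ᶠ_)
open import Data.List using (List; []; _∷_; length; map; foldr)
open import Data.List.Membership.Propositional using (_∈_)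
open import Data.List.Membership.Propositional.Properties using (∈-filter⁺; ∈-allFin)
open import Data.List.Relation.Unary.Any using (here; there)
open import Data.Product using (_×_; _,_; ∃-syntax)
open import Data.Product.Properties using (≡-dec)
open import Data.Sum using (_⊎_; [_,_])
open import Data.Empty using (⊥-elim)
open import Function using (_∘_)
open import Relation.Nullary using (Dec; ¬_)
open import Relation.Nullary.Decidable using (map′; _×-dec_; _→-dec_; _⊎-dec_; ¬?; toWitness)
open import Relation.Unary using (Decidable)
open import Relation.Binary.PropositionalEquality
  using (_≡_; _≢_; refl; sym; trans; cong; subst; module ≡-Reasoning)

Exhaustible : Set → Set₁
Exhaustible A = ∀ {P : A → Set} → Decidable P → Dec (∀ x → P x)

Bool-exhaustible : Exhaustible Bool
Bool-exhaustible P? =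
  map′ (λ (pf , pt) → λ { false → pf ; true → pt }) (λ h → h false , h true)
       (P? false ×-dec P? true)

×-exhaustible : ∀ {A B} → Exhaustible A → Exhaustible B → Exhaustible (A × B)
×-exhaustible ∀A? ∀B? P? =
  map′ (λ h (a , b) → h a b) (λ h a b → h (a , b))
       (∀A? λ a → ∀B? λ b → P? (a , b))

Z2³-exhaustible : Exhaustible Z2³
Z2³-exhaustible = ×-exhaustible Bool-exhaustible (×-exhaustible Bool-exhaustible Bool-exhaustible)

_≟_ : (x y : Z2³) → Dec (x ≡ y)
_≟_ = ≡-dec _≟ᴮ_ (≡-dec _≟ᴮ_ _≟ᴮ_)

⊕-comm : ∀ x y → x ⊕ y ≡ y ⊕ x
⊕-comm (a , b , c) (a′ , b′ , c′)
  rewrite xor-comm a a′ | xor-comm b b′ | xor-comm c c′ = refl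

⊕-assoc : ∀ x y z → (x ⊕ y) ⊕ z ≡ x ⊕ (y ⊕ z)
⊕-assoc (a , b , c) (a′ , b′ , c′) (a″ , b″ , c″)
  rewrite xor-assoc a a′ a″ | xor-assoc b b′ b″ | xor-assoc c c′ c″ = refl

⊕-identityˡ : ∀ x → 𝟘 ⊕ x ≡ x
⊕-identityˡ x = refl

⊕-identityʳ : ∀ x → x ⊕ 𝟘 ≡ x
⊕-identityʳ (a , b , c)
  rewrite xor-identityʳ a | xor-identityʳ b | xor-identityʳ c = refl

⊕-self : ∀ x → x ⊕ x ≡ 𝟘
⊕-self (a , b , c) rewrite xor-same a | xor-same b | xor-same c = refl

⊕≡𝟘⇒≡ : ∀ x y → x ⊕ y ≡ 𝟘 → x ≡ y
⊕≡𝟘⇒≡ x y x⊕y≡𝟘 = begin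
  x            ≡⟨ sym (⊕-identityʳ x) ⟩
  x ⊕ 𝟘        ≡⟨ cong (x ⊕_) (sym x⊕y≡𝟘) ⟩
  x ⊕ (x ⊕ y)  ≡⟨ sym (⊕-assoc x x y) ⟩
  (x ⊕ x) ⊕ y  ≡⟨ cong (_⊕ y) (⊕-self x) ⟩
  𝟘 ⊕ y        ≡⟨ ⊕-identityˡ y ⟩
  y            ∎
  where open ≡-Reasoning

⊕-rotate : ∀ x y z → x ⊕ (y ⊕ z) ≡ y ⊕ (z ⊕ x)
⊕-rotate x y z = trans (⊕-comm x (y ⊕ z)) (⊕-assoc y z x)

infix 4 _∈⟨_⟩ _∉⟨_⟩

_∈⟨_⟩ : Z2³ → Z2³ → Set
x ∈⟨ γ ⟩ = x ≡ 𝟘 ⊎ x ≡ γ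

_∉⟨_⟩ : Z2³ → Z2³ → Set
x ∉⟨ γ ⟩ = ¬ x ∈⟨ γ ⟩

-- A linear map Z₂³ → Z₂² with kernel {𝟘, γ} for γ ≢ 𝟘: add the multiple of γ
-- that clears the first coordinate where γ is 1, then drop that coordinate.
quotient : Z2³ → Z2³ → Bool × Bool
quotient (true , g₂ , g₃)  (x₁ , x₂ , x₃) = x₂ xor (x₁ ∧ g₂) , x₃ xor (x₁ ∧ g₃)
quotient (false , true , g₃) (x₁ , x₂ , x₃) = x₁ , x₃ xor (x₂ ∧ g₃)
quotient (false , false , _) (x₁ , x₂ , _) = x₁ , x₂

-- Injective on the three nonzero elements of Z₂²; (false , false) is a junk value.
nonzeroIndex : Bool × Bool → Fin 3
nonzeroIndex (true , false)  = zero
nonzeroIndex (false , true)  = suc zero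
nonzeroIndex (true , true)   = suc (suc zero)
nonzeroIndex (false , false) = suc (suc zero)

colour : Z2³ → Z2³ → Fin 3
colour γ = nonzeroIndex ∘ quotient γ

Separates : Z2³ → Z2³ → Z2³ → Set
Separates γ x y =
  γ ≢ 𝟘 → x ∉⟨ γ ⟩ → y ∉⟨ γ ⟩ → x ⊕ y ∉⟨ γ ⟩ → colour γ x ≢ colour γ y

colour-separates : ∀ γ x y → Separates γ x y
colour-separates = toWitness {a? = Z2³-exhaustible λ γ → Z2³-exhaustible λ x →
                                   Z2³-exhaustible λ y → separates? γ x y} _
  where
  _∈⟨_⟩? : ∀ x γ → Dec (x ∈⟨ γ ⟩)
  x ∈⟨ γ ⟩? = (x ≟ 𝟘) ⊎-dec (x ≟ γ)

  separates? : ∀ γ x y → Dec (Separates γ x y)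
  separates? γ x y =
    ¬? (γ ≟ 𝟘) →-dec ¬? (x ∈⟨ γ ⟩?) →-dec ¬? (y ∈⟨ γ ⟩?) →-dec ¬? ((x ⊕ y) ∈⟨ γ ⟩?)
      →-dec ¬? (colour γ x ≟ᶠ colour γ y)

module _ {E : Set} (f : E → Z2³) where

  distinct-sum-is-third : ∀ {xs : List E} {d e} → length xs ≡ 3 →
    foldr _⊕_ 𝟘 (map f xs) ≡ 𝟘 → d ∈ xs → e ∈ xs → d ≢ e →
    ∃[ w ] (w ∈ xs × f d ⊕ f e ≡ f w)
  distinct-sum-is-third {x ∷ y ∷ z ∷ []} refl sum≡𝟘 = third
    where
    xyz : List E
    xyz = x ∷ y ∷ z ∷ []

    a b c : Z2³
    a = f x
    b = f y
    c = f z

    abc≡𝟘 : a ⊕ (b ⊕ c) ≡ 𝟘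
    abc≡𝟘 = trans (cong (λ t → a ⊕ (b ⊕ t)) (sym (⊕-identityʳ c))) sum≡𝟘

    bca≡𝟘 : b ⊕ (c ⊕ a) ≡ 𝟘
    bca≡𝟘 = trans (sym (⊕-rotate a b c)) abc≡𝟘

    cab≡𝟘 : c ⊕ (a ⊕ b) ≡ 𝟘
    cab≡𝟘 = trans (sym (⊕-rotate b c a)) bca≡𝟘

    b⊕c≡a : b ⊕ c ≡ a
    b⊕c≡a = sym (⊕≡𝟘⇒≡ a (b ⊕ c) abc≡𝟘)

    c⊕a≡b : c ⊕ a ≡ b
    c⊕a≡b = sym (⊕≡𝟘⇒≡ b (c ⊕ a) bca≡𝟘)

    a⊕b≡c : a ⊕ b ≡ c
    a⊕b≡c = sym (⊕≡𝟘⇒≡ c (a ⊕ b) cab≡𝟘)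

    third : ∀ {d e} → d ∈ xyz → e ∈ xyz → d ≢ e → ∃[ w ] (w ∈ xyz × f d ⊕ f e ≡ f w)
    third (here refl)                 (there (here refl))         _ = z , there (there (here refl)) , a⊕b≡c
    third (there (here refl))         (there (there (here refl))) _ = x , here refl , b⊕c≡a
    third (there (there (here refl))) (here refl)                 _ = y , there (here refl) , c⊕a≡b
    third (there (here refl))         (here refl)                 _ = z , there (there (here refl)) , trans (⊕-comm b a) a⊕b≡c
    third (there (there (here refl))) (there (here refl))         _ = x , here refl , trans (⊕-comm c b) b⊕c≡a
    third (here refl)                 (there (there (here refl))) _ = y , there (here refl) , trans (⊕-comm a c) c⊕a≡b
    third (here refl)                 (here refl)                 d≢e = ⊥-elim (d≢e refl)
    third (there (here refl))         (there (here refl))         d≢e = ⊥-elim (d≢e refl)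
    third (there (there (here refl))) (there (there (here refl))) d≢e = ⊥-elim (d≢e refl)

theorem8 : (G : Graph) → Cubic G → Bridgeless G →
    (f : Fin (m G) → Z2³) → IsNZFlow G f →
    (γ : Z2³) → γ ≢ 𝟘 → (∀ e → f e ≢ γ) →
    ThreeEdgeColourable G
theorem8 G cubic _ f (nonzero , conservation) γ γ≢𝟘 f≢γ =
  colour γ ∘ f , λ d e d≢e (v , d∼v , e∼v) →
    let (w , _ , fd⊕fe≡fw) = distinct-sum-is-third f (cubic v) (conservation v)
                               (incident d d∼v) (incident e e∼v) d≢e
    in colour-separates γ (f d) (f e) γ≢𝟘 (outside d) (outside e)
         (subst (_∉⟨ γ ⟩) (sym fd⊕fe≡fw) (outside w))
  where
  outside : ∀ e → f e ∉⟨ γ ⟩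
  outside e = [ nonzero e , f≢γ e ]

  incident : ∀ {v} e → Incident G v e → e ∈ incEdges G v
  incident {v} e = ∈-filter⁺ (incident? G v) (∈-allFin e)
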